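{- Let $F$ be an eligible 3-uniform hypergraph with $\Delta(F)=k$, and let $A\subset V(F)$ be one of the two disjoint good sets of size $k-1$ that $F$ has by the definition of eligibility. Suppose $F'$ is the hypergraph obtained by taking two vertex-disjoint copies of $F$ and only identifying the vertices of the sets $A$ in both copies (each vertex of $A$ in the first copy identified with the same vertex of $A$ in the second copy). Then $F'$ is an eligible hypergraph with $\Delta(F')=k+1$ and $e(F')=2e(F)$.
   Context: For a 3-uniform hypergraph $F$, the deficiency is $\Delta(F)=v(F)-e(F)$, and for $U\subseteq V(F)$, $\Delta(U)$ denotes the deficiency of the induced subhypergraph $F[U]$. An independent set $A\subseteq V(F)$ is called good if every set $U$ with $A\subsetneq U\subseteq V(F)$ satisfies $\Delta(U)\geq |A|+1$. A 3-uniform hypergraph $F$ with $\Delta(F)=k\geq 1$ is called eligible if: (i) there are two disjoint good sets $A,B\subset V(F)$ with $|A|=|B|=k-1$; (ii) there exist two distinct vertices $u,v\in V(F)\setminus(A\cup B)$; (iii) at most $e(F)/4-k$ vertices of $F$ have degree more than 1, every edge of $F$ contains at most one vertex of degree 1, and $F$ has no isolated vertices; (iv) every $U\subseteq V(F)$ with $|U|\geq 2$ satisfies $\Delta(U)\geq 2$. -}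

module Defs where

open import Data.Nat using (ℕ; suc; _+_; _*_; _∸_; _≤_; _<_; _≥_)
open import Data.Integer as ℤ using (ℤ; +_; _-_)
open import Data.Fin using (Fin; _≟_)
open import Data.Fin.Subset using (Subset; _∈_; _∉_; _⊆_; _⊂_; _∩_; _∪_; ∣_∣; Empty)
open import Data.Fin.Subset.Properties using (_∈?_; _⊆?_)
open import Data.Fin.Properties using (any?)
open import Data.List using (List; length; filter; map; _++_)
open import Data.List.Membership.Propositional using () renaming (_∈_ to _∈ₗ_)
open import Data.List.Relation.Unary.All using (All)
open import Data.List.Relation.Unary.Unique.Propositional using (Unique)
open import Data.List.Relation.Binary.Permutation.Propositional using (_↭_)
open import Data.Vec using (tabulate)
open import Data.Product using (Σ; _×_; ∃; _,_)
open import Data.Sum using (_⊎_)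
open import Data.Bool using (Bool)
open import Relation.Nullary using (¬_; does)
open import Relation.Nullary.Decidable using (_×-dec_)
open import Relation.Binary.PropositionalEquality using (_≡_; _≢_)
open import Function.Definitions using (Injective)

record Hypergraph3 : Set where
  field
    n      : ℕ
    edges  : List (Subset n)
    unique : Unique edges
    three  : All (λ e → ∣ e ∣ ≡ 3) edges

open Hypergraph3 public

v : Hypergraph3 → ℕ
v F = n F

e : Hypergraph3 → ℕ
e F = length (edges F)

eInd : (F : Hypergraph3) → Subset (n F) → ℕ
eInd F U = length (filter (λ x → x ⊆? U) (edges F))

Δ : Hypergraph3 → ℤ
Δ F = + v F - + e F

ΔU : (F : Hypergraph3) → Subset (n F) → ℤ
ΔU F U = + ∣ U ∣ - + eInd F U

deg : (F : Hypergraph3) → Fin (n F) → ℕ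
deg F x = length (filter (λ f → x ∈? f) (edges F))

Independent : (F : Hypergraph3) → Subset (n F) → Set
Independent F A = ∀ f → f ∈ₗ edges F → ¬ (f ⊆ A)

Good : (F : Hypergraph3) → Subset (n F) → Set
Good F A = Independent F A ×
           (∀ (U : Subset (n F)) → A ⊂ U → ΔU F U ℤ.≥ + (suc ∣ A ∣))

Disjoint : ∀ {m} → Subset m → Subset m → Set
Disjoint A B = Empty (A ∩ B)

highDeg : (F : Hypergraph3) → ℕ
highDeg F = ∣ tabulate (λ x → does (1 Data.Nat.<? deg F x)) ∣
  where import Data.Nat

record EligibleWith (F : Hypergraph3) (k : ℕ) : Set where
  field
    k≥1     : k ≥ 1
    defic   : Δ F ≡ + k
    A B     : Subset (n F)
    goodA   : Good F A
    goodB   : Good F B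
    disjAB  : Disjoint A B
    sizeA   : ∣ A ∣ ≡ k ∸ 1
    sizeB   : ∣ B ∣ ≡ k ∸ 1
    u w     : Fin (n F)
    u≢w     : u ≢ w
    u∉A∪B   : u ∉ (A ∪ B)
    w∉A∪B   : w ∉ (A ∪ B)
    -- (iii)  #{deg > 1} ≤ e(F)/4 - k, written as 4(#{deg > 1} + k) ≤ e(F)
    fewHigh    : 4 * (highDeg F + k) ≤ e F
    oneLow     : ∀ f → f ∈ₗ edges F →
                   ∣ tabulate (λ x → does ((x ∈? f) ×-dec (deg F x Data.Nat.≟ 1))) ∣ ≤ 1
    noIsolated : ∀ x → deg F x ≥ 1
    dense   : ∀ (U : Subset (n F)) → ∣ U ∣ ≥ 2 → ΔU F U ℤ.≥ + 2

Eligible : Hypergraph3 → Set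
Eligible F = Σ ℕ (EligibleWith F)

image : ∀ {p q} → (Fin p → Fin q) → Subset p → Subset q
image ι S = tabulate (λ j → does (any? (λ i → (i ∈? S) ×-dec (ι i ≟ j))))

IsDoubleAlong : (F : Hypergraph3) → Subset (n F) → (G : Hypergraph3) →
                (Fin (n F) → Fin (n G)) → (Fin (n F) → Fin (n G)) → Set
IsDoubleAlong F A G ι₁ ι₂ =
  Injective _≡_ _≡_ ι₁ × Injective _≡_ _≡_ ι₂ ×
  (∀ x y → ι₁ x ≡ ι₂ y → x ≡ y × x ∈ A) ×
  (∀ x → x ∈ A → ι₁ x ≡ ι₂ x) ×
  (∀ z → ∃ (λ x → ι₁ x ≡ z) ⊎ ∃ (λ x → ι₂ x ≡ z)) ×
  (edges G ↭ (map (image ι₁) (edges F) ++ map (image ι₂) (edges F)))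

module Submission where

-- Let U₁, U₂ be the preimages of U ⊆ V(G) in the two copies. Every vertex of G has one preimage, the
-- glued ones two, so |U| + |A ∩ U₁| = |U₁| + |U₂|, while e_G(U) = e_F(U₁) + e_F(U₂): each deficiency
-- bound in G splits into one bound for U₁ and one for U₂ in F, given by goodness of A or B or by (iv).
-- The good sets of G are B in one copy together with u in the other (both ways round), the two distinct
-- vertices are the copies of w, degrees double on A and are unchanged elsewhere, and
-- v(G) = 2v(F) - |A|, e(G) = 2e(F) give Δ(G) = Δ(F) + 1.

open import Level using (Level)
open import Data.Bool using (Bool; true; false; _∧_)
open import Data.Nat as ℕ using (ℕ; zero; suc; _+_; _*_; _≤_; _<_; _≥_; z≤n; s≤s)
open import Data.Nat.Properties hiding (_≟_)
open import Data.Nat.Solver using (module +-*-Solver)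
import Data.Integer as ℤ
import Data.Integer.Properties as ℤ
open import Data.Fin using (Fin; zero; suc; _≟_)
open import Data.Fin.Properties using (any?)
open import Data.Fin.Subset using (Subset; _∈_; _∉_; _⊆_; _⊂_; _∩_; _∪_; ∣_∣; ⁅_⁆; Empty)
open import Data.Fin.Subset.Properties
  using (_∈?_; _⊆?_; p⊆q⇒∣p∣≤∣q∣; p⊂q⇒∣p∣<∣q∣; ∣⁅x⁆∣≡1; x∈⁅x⁆; x∈⁅y⁆⇒x≡y; x∈p∪q⁺; x∈p∪q⁻; x∈p∩q⁺; x∈p∩q⁻;
         p⊆p∪q; q⊆p∪q; ∩-comm; ⊆-antisym; Empty-unique; ∣⊥∣≡0; ∣p∩q∣≤∣q∣)
open import Data.Vec using ([]; _∷_; lookup; tabulate)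
open import Data.Vec.Properties using (lookup∘tabulate; lookup-zipWith; []=⇒lookup; lookup⇒[]=)
open import Data.List using (List; []; _∷_; length; filter; map; _++_)
open import Data.List.Properties using (filter-none; filter-++; filter-≐; length-++; length-map)
open import Data.List.Relation.Unary.All as All using (universal)
open import Data.List.Membership.Propositional using () renaming (_∈_ to _∈ₗ_)
open import Data.List.Membership.Propositional.Properties using (∈-++⁻; ∈-map⁻)
open import Data.List.Relation.Binary.Permutation.Propositional using (_↭_; ↭-trans)
open import Data.List.Relation.Binary.Permutation.Propositional.Properties using (filter-↭; ↭-length; ++-comm; ∈-resp-↭)
open import Data.Product using (∃; _×_; _,_; proj₁; proj₂)
open import Data.Sum using (_⊎_; inj₁; inj₂; swap)
open import Data.Empty using (⊥-elim)
open import Function.Definitions using (Injective)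
open import Relation.Binary.PropositionalEquality
open import Relation.Nullary using (¬_; Dec; yes; no; ¬?; does)
open import Relation.Nullary.Decidable using (_×-dec_; dec-true; dec-false; does-⇔)
open import Function.Bundles using (mk⇔)
open import Relation.Unary using (Pred; Decidable)
open import Algebra.Properties.Semiring.Sum +-*-semiring using (sum-syntax; sum-cong-≗; ∑-distrib-+; ∑-comm; *-distribˡ-sum)
open import Defs


𝟙 : Bool → ℕ
𝟙 true  = 1
𝟙 false = 0

𝟙≤1 : ∀ b → 𝟙 b ≤ 1
𝟙≤1 true  = s≤s z≤n
𝟙≤1 false = z≤n

𝟙-does-mono : ∀ {P Q : Set} (P? : Dec P) (Q? : Dec Q) → (P → Q) → 𝟙 (does P?) ≤ 𝟙 (does Q?)
𝟙-does-mono (yes p) Q? f rewrite dec-true Q? (f p) = ≤-refl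
𝟙-does-mono (no _)  Q? f = z≤n

∑-mono-≤ : ∀ {n} {f g : Fin n → ℕ} → (∀ i → f i ≤ g i) → ∑[ i < n ] f i ≤ ∑[ i < n ] g i
∑-mono-≤ {zero}  f≤g = z≤n
∑-mono-≤ {suc n} f≤g = +-mono-≤ (f≤g zero) (∑-mono-≤ (λ i → f≤g (suc i)))

∑-zero : ∀ {n} {f : Fin n → ℕ} → (∀ i → f i ≡ 0) → ∑[ i < n ] f i ≡ 0
∑-zero {zero}  f≡0 = refl
∑-zero {suc n} f≡0 = cong₂ _+_ (f≡0 zero) (∑-zero (λ i → f≡0 (suc i)))

∑-one : ∀ n → ∑[ i < n ] 1 ≡ n
∑-one zero    = refl
∑-one (suc n) = cong suc (∑-one n)

δ : ∀ {n} → Fin n → Fin n → ℕ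
δ a b = 𝟙 (does (a ≟ b))

∑-δ : ∀ {n} (a : Fin n) (g : Fin n → ℕ) → ∑[ j < n ] (δ a j * g j) ≡ g a
∑-δ {suc n} zero    g = trans (cong (g zero + 0 +_) (∑-zero {n} (λ _ → refl))) (trans (+-identityʳ _) (+-identityʳ _))
∑-δ {suc n} (suc a) g = ∑-δ a (λ j → g (suc j))

fibre : ∀ {m n} → (Fin m → ℕ) → (Fin m → Fin n) → Fin n → ℕ
fibre w ι z = ∑[ x < _ ] (w x * δ (ι x) z)

∑-reindex : ∀ {m n} (ι : Fin m → Fin n) (w : Fin m → ℕ) (f : Fin n → ℕ) →
            ∑[ x < m ] (w x * f (ι x)) ≡ ∑[ z < n ] (f z * fibre w ι z)
∑-reindex {m} {n} ι w f = begin
  ∑[ x < m ] (w x * f (ι x))                       ≡⟨ sum-cong-≗ (λ x → cong (w x *_) (sym (∑-δ (ι x) f))) ⟩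
  ∑[ x < m ] (w x * ∑[ z < n ] (δ (ι x) z * f z))  ≡⟨ sum-cong-≗ (λ x → *-distribˡ-sum (w x) (λ z → δ (ι x) z * f z)) ⟩
  ∑[ x < m ] ∑[ z < n ] (w x * (δ (ι x) z * f z))  ≡⟨ ∑-comm (λ x z → w x * (δ (ι x) z * f z)) ⟩
  ∑[ z < n ] ∑[ x < m ] (w x * (δ (ι x) z * f z))  ≡⟨ sum-cong-≗ (λ z → sum-cong-≗ (λ x → rearrange (w x) (δ (ι x) z) (f z))) ⟩
  ∑[ z < n ] ∑[ x < m ] (f z * (w x * δ (ι x) z))  ≡⟨ sum-cong-≗ (λ z → sym (*-distribˡ-sum (f z) (λ x → w x * δ (ι x) z))) ⟩
  ∑[ z < n ] (f z * fibre w ι z)                    ∎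
  where
  open ≡-Reasoning
  rearrange : ∀ a b c → a * (b * c) ≡ c * (a * b)
  rearrange a b c = trans (sym (*-assoc a b c)) (*-comm (a * b) c)

fibre-injective : ∀ {m n} (ι : Fin m → Fin n) → (∀ {x y} → ι x ≡ ι y → x ≡ y) →
                  ∀ y → fibre (λ _ → 1) ι (ι y) ≡ 1
fibre-injective ι inj y = trans (sum-cong-≗ same) (∑-δ y (λ _ → 1))
  where
  same : ∀ x → 1 * δ (ι x) (ι y) ≡ δ y x * 1
  same x = trans (+-identityʳ _)
                 (trans (cong 𝟙 (does-⇔ (mk⇔ (λ e → sym (inj e)) (λ e → cong ι (sym e))) (ι x ≟ ι y) (y ≟ x)))
                        (sym (*-identityʳ _)))

χ : ∀ {n} → Subset n → Fin n → ℕ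
χ p x = 𝟙 (lookup p x)

∈⇒lookup : ∀ {n} {p : Subset n} {x} → x ∈ p → lookup p x ≡ true
∈⇒lookup = []=⇒lookup

lookup⇒∈ : ∀ {n} {p : Subset n} {x} → lookup p x ≡ true → x ∈ p
lookup⇒∈ {p = p} {x} = lookup⇒[]= x p

∉⇒lookup : ∀ {n} {p : Subset n} {x} → ¬ x ∈ p → lookup p x ≡ false
∉⇒lookup {p = p} {x} x∉p with lookup p x in eq
... | true  = ⊥-elim (x∉p (lookup⇒∈ eq))
... | false = refl

∣p∣≡∑χ : ∀ {n} (p : Subset n) → ∣ p ∣ ≡ ∑[ x < n ] χ p x
∣p∣≡∑χ []            = refl
∣p∣≡∑χ (true  ∷ p) = cong suc (∣p∣≡∑χ p)
∣p∣≡∑χ (false ∷ p) = ∣p∣≡∑χ p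

∣tabulate∣≡∑ : ∀ {n} (g : Fin n → Bool) → ∣ tabulate g ∣ ≡ ∑[ x < n ] 𝟙 (g x)
∣tabulate∣≡∑ g = trans (∣p∣≡∑χ (tabulate g)) (sum-cong-≗ (λ x → cong 𝟙 (lookup∘tabulate g x)))

∣p∩q∣≡∑χχ : ∀ {n} (p q : Subset n) → ∣ p ∩ q ∣ ≡ ∑[ x < n ] (χ p x * χ q x)
∣p∩q∣≡∑χχ p q = trans (∣p∣≡∑χ (p ∩ q)) (sum-cong-≗ λ x → trans (cong 𝟙 (lookup-zipWith _ x p q)) (χχ (lookup p x) (lookup q x)))
  where
  χχ : ∀ a b → 𝟙 (a ∧ b) ≡ 𝟙 a * 𝟙 b
  χχ true  b = sym (+-identityʳ _)
  χχ false b = refl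

∣p∪q∣+∣p∩q∣≡∣p∣+∣q∣ : ∀ {n} (p q : Subset n) → ∣ p ∪ q ∣ + ∣ p ∩ q ∣ ≡ ∣ p ∣ + ∣ q ∣
∣p∪q∣+∣p∩q∣≡∣p∣+∣q∣ []          []          = refl
∣p∪q∣+∣p∩q∣≡∣p∣+∣q∣ (true ∷ p)  (true ∷ q)  =
  cong suc (trans (+-suc _ _) (trans (cong suc (∣p∪q∣+∣p∩q∣≡∣p∣+∣q∣ p q)) (sym (+-suc _ _))))
∣p∪q∣+∣p∩q∣≡∣p∣+∣q∣ (true ∷ p)  (false ∷ q) = cong suc (∣p∪q∣+∣p∩q∣≡∣p∣+∣q∣ p q)
∣p∪q∣+∣p∩q∣≡∣p∣+∣q∣ (false ∷ p) (true ∷ q)  = trans (cong suc (∣p∪q∣+∣p∩q∣≡∣p∣+∣q∣ p q)) (sym (+-suc _ _))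
∣p∪q∣+∣p∩q∣≡∣p∣+∣q∣ (false ∷ p) (false ∷ q) = ∣p∪q∣+∣p∩q∣≡∣p∣+∣q∣ p q

private
  i-j+j≡i : ∀ i j → i ℤ.- j ℤ.+ j ≡ i
  i-j+j≡i i j = trans (ℤ.+-assoc i (ℤ.- j) j) (trans (cong (ℤ._+_ i) (ℤ.+-inverseˡ j)) (ℤ.+-identityʳ i))

  +[m+n]-n≡m : ∀ m n → ℤ.+ (m + n) ℤ.- ℤ.+ n ≡ ℤ.+ m
  +[m+n]-n≡m m n = trans (cong (ℤ._- ℤ.+ n) (ℤ.pos-+ m n)) (i+j-j≡i (ℤ.+ m) (ℤ.+ n))
    where
    i+j-j≡i : ∀ i j → i ℤ.+ j ℤ.- j ≡ i
    i+j-j≡i i j = trans (ℤ.+-assoc i j (ℤ.- j)) (trans (cong (ℤ._+_ i) (ℤ.+-inverseʳ j)) (ℤ.+-identityʳ i))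

+a-+b≥+c⇒c+b≤a : ∀ a b c → ℤ.+ a ℤ.- ℤ.+ b ℤ.≥ ℤ.+ c → c + b ≤ a
+a-+b≥+c⇒c+b≤a a b c h = ℤ.drop‿+≤+ (begin
  ℤ.+ (c + b)                 ≡⟨ ℤ.pos-+ c b ⟩
  ℤ.+ c ℤ.+ ℤ.+ b             ≤⟨ ℤ.+-monoˡ-≤ (ℤ.+ b) h ⟩
  ℤ.+ a ℤ.- ℤ.+ b ℤ.+ ℤ.+ b   ≡⟨ i-j+j≡i (ℤ.+ a) (ℤ.+ b) ⟩
  ℤ.+ a                       ∎)
  where open ℤ.≤-Reasoning

c+b≤a⇒+a-+b≥+c : ∀ a b c → c + b ≤ a → ℤ.+ a ℤ.- ℤ.+ b ℤ.≥ ℤ.+ c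
c+b≤a⇒+a-+b≥+c a b c h = begin
  ℤ.+ c                   ≡⟨ +[m+n]-n≡m c b ⟨
  ℤ.+ (c + b) ℤ.- ℤ.+ b   ≤⟨ ℤ.+-monoˡ-≤ (ℤ.- ℤ.+ b) (ℤ.+≤+ h) ⟩
  ℤ.+ a ℤ.- ℤ.+ b         ∎
  where open ℤ.≤-Reasoning

+a-+b≡+c⇒a≡c+b : ∀ a b c → ℤ.+ a ℤ.- ℤ.+ b ≡ ℤ.+ c → a ≡ c + b
+a-+b≡+c⇒a≡c+b a b c h = ℤ.+-injective (begin
  ℤ.+ a                       ≡⟨ i-j+j≡i (ℤ.+ a) (ℤ.+ b) ⟨
  ℤ.+ a ℤ.- ℤ.+ b ℤ.+ ℤ.+ b   ≡⟨ cong (ℤ._+ ℤ.+ b) h ⟩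
  ℤ.+ c ℤ.+ ℤ.+ b             ≡⟨ ℤ.pos-+ c b ⟨
  ℤ.+ (c + b)                 ∎)
  where open ≡-Reasoning

a≡c+b⇒+a-+b≡+c : ∀ a b c → a ≡ c + b → ℤ.+ a ℤ.- ℤ.+ b ≡ ℤ.+ c
a≡c+b⇒+a-+b≡+c .(c + b) b c refl = +[m+n]-n≡m c b

private variable
  ℓ p : Level
  X Y : Set ℓ

length-filter-map : ∀ {P : Pred Y p} (P? : Decidable P) (f : X → Y) xs →
                    length (filter P? (map f xs)) ≡ length (filter (λ x → P? (f x)) xs)
length-filter-map P? f []       = refl
length-filter-map P? f (x ∷ xs) with does (P? (f x))
... | true  = cong suc (length-filter-map P? f xs)
... | false = length-filter-map P? f xs

length-filter-mono : ∀ {P Q : Pred X p} (P? : Decidable P) (Q? : Decidable Q) → (∀ {x} → P x → Q x) →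
                     ∀ xs → length (filter P? xs) ≤ length (filter Q? xs)
length-filter-mono P? Q? P⇒Q []       = z≤n
length-filter-mono P? Q? P⇒Q (x ∷ xs) with P? x | Q? x
... | yes _  | yes _  = s≤s (length-filter-mono P? Q? P⇒Q xs)
... | yes px | no ¬qx = ⊥-elim (¬qx (P⇒Q px))
... | no _   | yes _  = m≤n⇒m≤1+n (length-filter-mono P? Q? P⇒Q xs)
... | no _   | no _   = length-filter-mono P? Q? P⇒Q xs

length-filter-none : ∀ {P : Pred X p} (P? : Decidable P) → (∀ x → ¬ P x) → ∀ xs → length (filter P? xs) ≡ 0
length-filter-none P? ¬P xs = cong length (filter-none P? (universal ¬P xs))

two≤∣p∣ : ∀ {n} {p : Subset n} {x y} → x ≢ y → x ∈ p → y ∈ p → 2 ≤ ∣ p ∣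
two≤∣p∣ {p = p} {x} {y} x≢y x∈p y∈p =
  subst (_< ∣ p ∣) (∣⁅x⁆∣≡1 x) (p⊂q⇒∣p∣<∣q∣ (⁅x⁆⊆p , y , y∈p , λ y∈⁅x⁆ → x≢y (sym (x∈⁅y⁆⇒x≡y x y∈⁅x⁆))))
  where
  ⁅x⁆⊆p : ⁅ x ⁆ ⊆ p
  ⁅x⁆⊆p z∈⁅x⁆ = subst (_∈ p) (sym (x∈⁅y⁆⇒x≡y x z∈⁅x⁆)) x∈p

preimage : ∀ {m n} → (Fin m → Fin n) → Subset n → Subset m
preimage ι U = tabulate (λ x → lookup U (ι x))

module _ {m n} {ι : Fin m → Fin n} where

  χ-preimage : ∀ U x → χ (preimage ι U) x ≡ χ U (ι x)
  χ-preimage U x = cong 𝟙 (lookup∘tabulate (λ x → lookup U (ι x)) x)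

  ∈-preimage⁺ : ∀ {U x} → ι x ∈ U → x ∈ preimage ι U
  ∈-preimage⁺ {U} {x} ιx∈U = lookup⇒∈ (trans (lookup∘tabulate (λ x → lookup U (ι x)) x) (∈⇒lookup ιx∈U))

  ∈-preimage⁻ : ∀ {U x} → x ∈ preimage ι U → ι x ∈ U
  ∈-preimage⁻ {U} {x} x∈ = lookup⇒∈ (trans (sym (lookup∘tabulate (λ x → lookup U (ι x)) x)) (∈⇒lookup x∈))

  ∈-image⁺ : ∀ {S x} → x ∈ S → ι x ∈ image ι S
  ∈-image⁺ {S} {x} x∈S = lookup⇒∈ (trans (lookup∘tabulate _ (ι x))
    (dec-true (any? (λ y → (y ∈? S) ×-dec (ι y ≟ ι x))) (x , x∈S , refl)))

  ∈-image⁻ : ∀ {S z} → z ∈ image ι S → ∃ λ x → x ∈ S × ι x ≡ z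
  ∈-image⁻ {S} {z} z∈ with any? (λ x → (x ∈? S) ×-dec (ι x ≟ z)) in eq
  ... | yes found = found
  ... | no _ with () ← trans (sym (∈⇒lookup z∈)) (trans (lookup∘tabulate _ z) (cong does eq))

  image⊆⇒⊆preimage : ∀ {S U} → image ι S ⊆ U → S ⊆ preimage ι U
  image⊆⇒⊆preimage img⊆U x∈S = ∈-preimage⁺ (img⊆U (∈-image⁺ x∈S))

  ⊆preimage⇒image⊆ : ∀ {S U} → S ⊆ preimage ι U → image ι S ⊆ U
  ⊆preimage⇒image⊆ S⊆ z∈ with ∈-image⁻ z∈
  ... | x , x∈S , refl = ∈-preimage⁻ (S⊆ x∈S)

module _ (F : Hypergraph3) where

  eInd-mono : ∀ {W X} → W ⊆ X → eInd F W ≤ eInd F X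
  eInd-mono {W} {X} W⊆X = length-filter-mono (_⊆? W) (_⊆? X) (λ f⊆W x∈f → W⊆X (f⊆W x∈f)) (edges F)

  eInd-independent : ∀ {W} → Independent F W → eInd F W ≡ 0
  eInd-independent {W} indep = cong length (filter-none (_⊆? W) (All.tabulate (λ {f} f∈ → indep f f∈)))

  -- Δ(W ∪ A) ≥ |A| + 1 because W ∪ A ⊋ A, while Δ(W ∪ A) ≤ Δ(W) + |A| - |A ∩ W|.
  good-extension : ∀ {A} → Good F A → ∀ {W x} → x ∈ W → x ∉ A → suc (eInd F W + ∣ A ∩ W ∣) ≤ ∣ W ∣
  good-extension {A} (_ , good) {W} {x} x∈W x∉A = +-cancelˡ-≤ ∣ A ∣ _ _ (begin
    ∣ A ∣ + suc (eInd F W + ∣ A ∩ W ∣)    ≡⟨ +-suc ∣ A ∣ _ ⟩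
    suc ∣ A ∣ + (eInd F W + ∣ A ∩ W ∣)    ≡⟨ +-assoc (suc ∣ A ∣) _ _ ⟨
    suc ∣ A ∣ + eInd F W + ∣ A ∩ W ∣      ≤⟨ +-monoˡ-≤ ∣ A ∩ W ∣ (+-monoʳ-≤ (suc ∣ A ∣) (eInd-mono (p⊆p∪q A))) ⟩
    suc ∣ A ∣ + eInd F (W ∪ A) + ∣ A ∩ W ∣ ≤⟨ +-monoˡ-≤ ∣ A ∩ W ∣ Δ[W∪A]≥ ⟩
    ∣ W ∪ A ∣ + ∣ A ∩ W ∣                  ≡⟨ cong (∣ W ∪ A ∣ +_) (cong ∣_∣ (∩-comm A W)) ⟩
    ∣ W ∪ A ∣ + ∣ W ∩ A ∣                  ≡⟨ ∣p∪q∣+∣p∩q∣≡∣p∣+∣q∣ W A ⟩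
    ∣ W ∣ + ∣ A ∣                          ≡⟨ +-comm ∣ W ∣ ∣ A ∣ ⟩
    ∣ A ∣ + ∣ W ∣                          ∎)
    where
    open ≤-Reasoning
    Δ[W∪A]≥ : suc ∣ A ∣ + eInd F (W ∪ A) ≤ ∣ W ∪ A ∣
    Δ[W∪A]≥ = +a-+b≥+c⇒c+b≤a _ _ _ (good (W ∪ A) (q⊆p∪q W A , x , x∈p∪q⁺ (inj₁ x∈W) , x∉A))

split-bound : ∀ a b {u s u₁ u₂ e₁ e₂} → u + s ≡ u₁ + u₂ → a + e₁ ≤ u₁ → b + (e₂ + s) ≤ u₂ → b + a + (e₁ + e₂) ≤ u
split-bound a b {u} {s} {u₁} {u₂} {e₁} {e₂} u+s≡ h₁ h₂ = +-cancelʳ-≤ s _ _ (begin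
  b + a + (e₁ + e₂) + s     ≡⟨ solve 5 (λ a b e₁ e₂ s → b :+ a :+ (e₁ :+ e₂) :+ s := (a :+ e₁) :+ (b :+ (e₂ :+ s))) refl a b e₁ e₂ s ⟩
  (a + e₁) + (b + (e₂ + s)) ≤⟨ +-mono-≤ h₁ h₂ ⟩
  u₁ + u₂                   ≡⟨ u+s≡ ⟨
  u + s                     ∎)
  where
  open ≤-Reasoning
  open +-*-Solver

IsDoubleAlong-swap : ∀ {F A G ι₁ ι₂} → IsDoubleAlong F A G ι₁ ι₂ → IsDoubleAlong F A G ι₂ ι₁
IsDoubleAlong-swap {F} {A} {ι₁ = ι₁} {ι₂} (ι₁-inj , ι₂-inj , cross , glue , surj , perm) =
  ι₂-inj , ι₁-inj , cross′ , (λ x x∈A → sym (glue x x∈A)) , (λ z → swap (surj z)) , ↭-trans perm (++-comm (map (image ι₁) (edges F)) _)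
  where
  cross′ : ∀ x y → ι₂ x ≡ ι₁ y → x ≡ y × x ∈ A
  cross′ x y ι₂x≡ι₁y with cross y x (sym ι₂x≡ι₁y)
  ... | refl , x∈A = refl , x∈A

module Doubling {F G : Hypergraph3} {A : Subset (n F)} {ι₁ ι₂ : Fin (n F) → Fin (n G)}
                (D : IsDoubleAlong F A G ι₁ ι₂) where

  ι₁-injective : Injective _≡_ _≡_ ι₁
  ι₁-injective = proj₁ D

  ι₂-injective : Injective _≡_ _≡_ ι₂
  ι₂-injective = proj₁ (proj₂ D)

  cross : ∀ x y → ι₁ x ≡ ι₂ y → x ≡ y × x ∈ A
  cross = proj₁ (proj₂ (proj₂ D))

  glue : ∀ x → x ∈ A → ι₁ x ≡ ι₂ x
  glue = proj₁ (proj₂ (proj₂ (proj₂ D)))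

  covered : ∀ z → ∃ (λ x → ι₁ x ≡ z) ⊎ ∃ (λ x → ι₂ x ≡ z)
  covered = proj₁ (proj₂ (proj₂ (proj₂ (proj₂ D))))

  private
    copies₁ copies₂ : List (Subset (n G))
    copies₁ = map (image ι₁) (edges F)
    copies₂ = map (image ι₂) (edges F)

    perm : edges G ↭ (copies₁ ++ copies₂)
    perm = proj₂ (proj₂ (proj₂ (proj₂ (proj₂ D))))

    fibres-at-ι₂ : ∀ y → fibre (λ _ → 1) ι₁ (ι₂ y) + fibre (λ _ → 1) ι₂ (ι₂ y) ≡ 1 + fibre (χ A) ι₁ (ι₂ y)
    fibres-at-ι₂ y = trans (cong₂ _+_ (sum-cong-≗ glued) (fibre-injective ι₂ ι₂-injective y)) (+-comm _ 1)
      where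
      glued : ∀ x → 1 * δ (ι₁ x) (ι₂ y) ≡ χ A x * δ (ι₁ x) (ι₂ y)
      glued x with ι₁ x ≟ ι₂ y
      ... | yes e rewrite ∈⇒lookup (proj₂ (cross x y e)) = refl
      ... | no _  = sym (*-zeroʳ (χ A x))

  fibres : ∀ z → fibre (λ _ → 1) ι₁ z + fibre (λ _ → 1) ι₂ z ≡ 1 + fibre (χ A) ι₁ z
  fibres z with covered z
  ... | inj₂ (y , refl) = fibres-at-ι₂ y
  ... | inj₁ (x , refl) with x ∈? A
  ...   | yes x∈A rewrite glue x x∈A = fibres-at-ι₂ x
  ...   | no x∉A = cong₂ _+_ (fibre-injective ι₁ ι₁-injective x) (trans (∑-zero {n F} missed₂) (sym (∑-zero {n F} missedA)))
    where
    missed₂ : ∀ y → 1 * δ (ι₂ y) (ι₁ x) ≡ 0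
    missed₂ y with ι₂ y ≟ ι₁ x
    ... | yes e = ⊥-elim (x∉A (proj₂ (cross x y (sym e))))
    ... | no _  = refl
    missedA : ∀ y → χ A y * δ (ι₁ y) (ι₁ x) ≡ 0
    missedA y with ι₁ y ≟ ι₁ x
    ... | yes e rewrite ι₁-injective e | ∉⇒lookup x∉A = refl
    ... | no _  = *-zeroʳ (χ A y)

  double-count : ∀ (f : Fin (n G) → ℕ) →
                 ∑[ x < n F ] f (ι₁ x) + ∑[ x < n F ] f (ι₂ x) ≡ ∑[ z < n G ] f z + ∑[ x < n F ] (χ A x * f (ι₁ x))
  double-count f = begin
    ∑[ x < n F ] f (ι₁ x) + ∑[ x < n F ] f (ι₂ x)
      ≡⟨ cong₂ _+_ (sum-cong-≗ (λ x → sym (*-identityˡ (f (ι₁ x))))) (sum-cong-≗ (λ x → sym (*-identityˡ (f (ι₂ x))))) ⟩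
    ∑[ x < n F ] (1 * f (ι₁ x)) + ∑[ x < n F ] (1 * f (ι₂ x))
      ≡⟨ cong₂ _+_ (∑-reindex ι₁ (λ _ → 1) f) (∑-reindex ι₂ (λ _ → 1) f) ⟩
    ∑[ z < n G ] (f z * c₁ z) + ∑[ z < n G ] (f z * c₂ z)
      ≡⟨ ∑-distrib-+ (λ z → f z * c₁ z) (λ z → f z * c₂ z) ⟨
    ∑[ z < n G ] (f z * c₁ z + f z * c₂ z)
      ≡⟨ sum-cong-≗ (λ z → trans (sym (*-distribˡ-+ (f z) (c₁ z) (c₂ z))) (trans (cong (f z *_) (fibres z))
                              (trans (*-distribˡ-+ (f z) 1 (cA z)) (cong (_+ f z * cA z) (*-identityʳ (f z)))))) ⟩
    ∑[ z < n G ] (f z + f z * cA z)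
      ≡⟨ ∑-distrib-+ f (λ z → f z * cA z) ⟩
    ∑[ z < n G ] f z + ∑[ z < n G ] (f z * cA z)
      ≡⟨ cong (∑[ z < n G ] f z +_) (∑-reindex ι₁ (χ A) f) ⟨
    ∑[ z < n G ] f z + ∑[ x < n F ] (χ A x * f (ι₁ x)) ∎
    where
    open ≡-Reasoning
    c₁ c₂ cA : Fin (n G) → ℕ
    c₁ = fibre (λ _ → 1) ι₁
    c₂ = fibre (λ _ → 1) ι₂
    cA = fibre (χ A) ι₁

  ∑≤∑∘ι₁+∑∘ι₂ : ∀ (f : Fin (n G) → ℕ) → ∑[ z < n G ] f z ≤ ∑[ x < n F ] f (ι₁ x) + ∑[ x < n F ] f (ι₂ x)
  ∑≤∑∘ι₁+∑∘ι₂ f = ≤-trans (m≤m+n _ _) (≤-reflexive (sym (double-count f)))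

  v-double : v G + ∣ A ∣ ≡ v F + v F
  v-double = begin
    v G + ∣ A ∣
      ≡⟨ cong₂ _+_ (∑-one (n G)) (trans (sum-cong-≗ (λ x → *-identityʳ (χ A x))) (sym (∣p∣≡∑χ A))) ⟨
    ∑[ z < n G ] 1 + ∑[ x < n F ] (χ A x * 1)        ≡⟨ double-count (λ _ → 1) ⟨
    ∑[ x < n F ] 1 + ∑[ x < n F ] 1                  ≡⟨ cong₂ _+_ (∑-one (n F)) (∑-one (n F)) ⟩
    v F + v F                                        ∎
    where open ≡-Reasoning

  ∣∣-split : ∀ U → ∣ U ∣ + ∣ A ∩ preimage ι₁ U ∣ ≡ ∣ preimage ι₁ U ∣ + ∣ preimage ι₂ U ∣
  ∣∣-split U = begin
    ∣ U ∣ + ∣ A ∩ preimage ι₁ U ∣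
      ≡⟨ cong₂ _+_ (∣p∣≡∑χ U)
                   (trans (∣p∩q∣≡∑χχ A (preimage ι₁ U)) (sum-cong-≗ (λ x → cong (χ A x *_) (χ-preimage {ι = ι₁} U x)))) ⟩
    ∑[ z < n G ] χ U z + ∑[ x < n F ] (χ A x * χ U (ι₁ x))
      ≡⟨ double-count (χ U) ⟨
    ∑[ x < n F ] χ U (ι₁ x) + ∑[ x < n F ] χ U (ι₂ x)
      ≡⟨ cong₂ _+_ (∣preimage∣ ι₁) (∣preimage∣ ι₂) ⟨
    ∣ preimage ι₁ U ∣ + ∣ preimage ι₂ U ∣ ∎
    where
    open ≡-Reasoning
    ∣preimage∣ : ∀ ι → ∣ preimage ι U ∣ ≡ ∑[ x < n F ] χ U (ι x)
    ∣preimage∣ ι = trans (∣p∣≡∑χ (preimage ι U)) (sum-cong-≗ (χ-preimage {ι = ι} U))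

  ∣A∩preimage₂∣≡∣A∩preimage₁∣ : ∀ U → ∣ A ∩ preimage ι₂ U ∣ ≡ ∣ A ∩ preimage ι₁ U ∣
  ∣A∩preimage₂∣≡∣A∩preimage₁∣ U =
    ≤-antisym (p⊆q⇒∣p∣≤∣q∣ (move (λ x∈A → sym (glue _ x∈A)))) (p⊆q⇒∣p∣≤∣q∣ (move (glue _)))
    where
    move : ∀ {ι ι′ : Fin (n F) → Fin (n G)} → (∀ {x} → x ∈ A → ι x ≡ ι′ x) → A ∩ preimage ι U ⊆ A ∩ preimage ι′ U
    move ι≡ι′ x∈ with x∈p∩q⁻ A _ x∈
    ... | x∈A , x∈U = x∈p∩q⁺ (x∈A , ∈-preimage⁺ (subst (_∈ U) (ι≡ι′ x∈A) (∈-preimage⁻ x∈U)))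

  length-filter-edges : ∀ {p} {P : Pred (Subset (n G)) p} (P? : Decidable P) →
                        length (filter P? (edges G)) ≡
                        length (filter (λ f → P? (image ι₁ f)) (edges F)) + length (filter (λ f → P? (image ι₂ f)) (edges F))
  length-filter-edges P? = begin
    length (filter P? (edges G))                            ≡⟨ ↭-length (filter-↭ P? perm) ⟩
    length (filter P? (copies₁ ++ copies₂))                 ≡⟨ cong length (filter-++ P? copies₁ copies₂) ⟩
    length (filter P? copies₁ ++ filter P? copies₂)         ≡⟨ length-++ (filter P? copies₁) ⟩
    length (filter P? copies₁) + length (filter P? copies₂)
      ≡⟨ cong₂ _+_ (length-filter-map P? (image ι₁) (edges F)) (length-filter-map P? (image ι₂) (edges F)) ⟩
    length (filter (λ f → P? (image ι₁ f)) (edges F)) + length (filter (λ f → P? (image ι₂ f)) (edges F)) ∎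
    where open ≡-Reasoning

  e-double : e G ≡ 2 * e F
  e-double = begin
    e G                                       ≡⟨ ↭-length perm ⟩
    length (copies₁ ++ copies₂)               ≡⟨ length-++ copies₁ ⟩
    length copies₁ + length copies₂           ≡⟨ cong₂ _+_ (length-map (image ι₁) (edges F)) (length-map (image ι₂) (edges F)) ⟩
    e F + e F                                 ≡⟨ cong (e F +_) (+-identityʳ (e F)) ⟨
    2 * e F                                   ∎
    where open ≡-Reasoning

  eInd-split : ∀ U → eInd G U ≡ eInd F (preimage ι₁ U) + eInd F (preimage ι₂ U)
  eInd-split U = trans (length-filter-edges (_⊆? U)) (cong₂ _+_ (pull ι₁) (pull ι₂))
    where
    pull : ∀ ι → length (filter (λ f → image ι f ⊆? U) (edges F)) ≡ eInd F (preimage ι U)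
    pull ι = cong length (filter-≐ (λ f → image ι f ⊆? U) (_⊆? preimage ι U) (image⊆⇒⊆preimage , ⊆preimage⇒image⊆) (edges F))

  ∈-image-ι₁ : ∀ {x f} → ι₁ x ∈ image ι₁ f → x ∈ f
  ∈-image-ι₁ ιx∈ with ∈-image⁻ ιx∈
  ... | y , y∈f , ι₁y≡ι₁x = subst (_∈ _) (ι₁-injective ι₁y≡ι₁x) y∈f

  private
    ∈-image-ι₂ : ∀ {x f} → ι₁ x ∈ image ι₂ f → x ∈ f × x ∈ A
    ∈-image-ι₂ ιx∈ with ∈-image⁻ ιx∈
    ... | y , y∈f , ι₂y≡ι₁x with cross _ y (sym ι₂y≡ι₁x)
    ...   | refl , x∈A = y∈f , x∈A

  deg-ι₁ : ∀ x → deg G (ι₁ x) ≡ deg F x + length (filter (λ f → ι₁ x ∈? image ι₂ f) (edges F))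
  deg-ι₁ x = trans (length-filter-edges (ι₁ x ∈?_)) (cong (_+ in-copy₂) in-copy₁)
    where
    in-copy₂ : ℕ
    in-copy₂ = length (filter (λ f → ι₁ x ∈? image ι₂ f) (edges F))
    in-copy₁ : length (filter (λ f → ι₁ x ∈? image ι₁ f) (edges F)) ≡ deg F x
    in-copy₁ = cong length (filter-≐ (λ f → ι₁ x ∈? image ι₁ f) (x ∈?_) (∈-image-ι₁ , ∈-image⁺) (edges F))

  deg-ι₁-outside : ∀ {x} → x ∉ A → deg G (ι₁ x) ≡ deg F x
  deg-ι₁-outside {x} x∉A = trans (deg-ι₁ x)
    (trans (cong (deg F x +_) (length-filter-none (λ f → ι₁ x ∈? image ι₂ f) (λ f ιx∈ → x∉A (proj₂ (∈-image-ι₂ ιx∈))) (edges F)))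
           (+-identityʳ (deg F x)))

  deg-ι₁-inside : ∀ {x} → x ∈ A → deg G (ι₁ x) ≡ deg F x + deg F x
  deg-ι₁-inside {x} x∈A = trans (deg-ι₁ x)
    (cong (deg F x +_) (cong length (filter-≐ (λ f → ι₁ x ∈? image ι₂ f) (x ∈?_)
      ((λ ιx∈ → proj₁ (∈-image-ι₂ ιx∈)) , λ x∈f → subst (_∈ _) (sym (glue x x∈A)) (∈-image⁺ x∈f)) (edges F))))

  edge-origin : ∀ {f′} → f′ ∈ₗ edges G → ∃ λ f → f ∈ₗ edges F × (f′ ≡ image ι₁ f ⊎ f′ ≡ image ι₂ f)
  edge-origin f′∈ with ∈-++⁻ (map (image ι₁) (edges F)) (∈-resp-↭ perm f′∈)
  ... | inj₁ f′∈₁ = let f , f∈ , eq = ∈-map⁻ (image ι₁) f′∈₁ in f , f∈ , inj₁ eq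
  ... | inj₂ f′∈₂ = let f , f∈ , eq = ∈-map⁻ (image ι₂) f′∈₂ in f , f∈ , inj₂ eq

  deficiency-split : ∀ U a b →
                     a + eInd F (preimage ι₁ U) ≤ ∣ preimage ι₁ U ∣ →
                     b + (eInd F (preimage ι₂ U) + ∣ A ∩ preimage ι₂ U ∣) ≤ ∣ preimage ι₂ U ∣ →
                     b + a + eInd G U ≤ ∣ U ∣
  deficiency-split U a b h₁ h₂ rewrite eInd-split U =
    split-bound a b (∣∣-split U) h₁
      (subst (λ s → b + (eInd F (preimage ι₂ U) + s) ≤ ∣ preimage ι₂ U ∣) (∣A∩preimage₂∣≡∣A∩preimage₁∣ U) h₂)

module DoubleOfEligible {F G : Hypergraph3} {k : ℕ} {ι₁ ι₂ : Fin (n F) → Fin (n G)}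
                       (el : EligibleWith F (suc k)) (D : IsDoubleAlong F (EligibleWith.A el) G ι₁ ι₂) where
  open EligibleWith el
  open Doubling {F} {G} {A} {ι₁} {ι₂} D

  u∉A : u ∉ A
  u∉A u∈A = u∉A∪B (x∈p∪q⁺ (inj₁ u∈A))

  u∉B : u ∉ B
  u∉B u∈B = u∉A∪B (x∈p∪q⁺ (inj₂ u∈B))

  ∣A∩W∣≡0 : ∀ {W} → W ⊆ B → ∣ A ∩ W ∣ ≡ 0
  ∣A∩W∣≡0 {W} W⊆B = trans (cong ∣_∣ (Empty-unique empty)) (∣⊥∣≡0 (n F))
    where
    empty : Empty (A ∩ W)
    empty (x , x∈A∩W) with x∈p∩q⁻ A W x∈A∩W
    ... | x∈A , x∈W = disjAB (x , x∈p∩q⁺ (x∈A , W⊆B x∈W))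

  A′ : Subset (n G)
  A′ = image ι₁ B ∪ ⁅ ι₂ u ⁆

  ι₂u∈A′ : ι₂ u ∈ A′
  ι₂u∈A′ = x∈p∪q⁺ (inj₂ (x∈⁅x⁆ (ι₂ u)))

  ι₁∈A′⇒∈B : ∀ {x} → ι₁ x ∈ A′ → x ∈ B
  ι₁∈A′⇒∈B {x} ι₁x∈ with x∈p∪q⁻ (image ι₁ B) ⁅ ι₂ u ⁆ ι₁x∈
  ... | inj₁ ι₁x∈B₁ with ∈-image⁻ ι₁x∈B₁
  ...   | y , y∈B , ι₁y≡ι₁x = subst (_∈ B) (ι₁-injective ι₁y≡ι₁x) y∈B
  ι₁∈A′⇒∈B {x} ι₁x∈ | inj₂ ι₁x≡ι₂u with cross x u (x∈⁅y⁆⇒x≡y (ι₂ u) ι₁x≡ι₂u)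
  ... | refl , u∈A = ⊥-elim (u∉A u∈A)

  ∈B⇒ι₁∈A′ : ∀ {x} → x ∈ B → ι₁ x ∈ A′
  ∈B⇒ι₁∈A′ x∈B = x∈p∪q⁺ (inj₁ (∈-image⁺ x∈B))

  ι₂∈A′⇒≡u : ∀ {x} → ι₂ x ∈ A′ → x ≡ u
  ι₂∈A′⇒≡u {x} ι₂x∈ with x∈p∪q⁻ (image ι₁ B) ⁅ ι₂ u ⁆ ι₂x∈
  ... | inj₂ ι₂x≡ι₂u = ι₂-injective (x∈⁅y⁆⇒x≡y (ι₂ u) ι₂x≡ι₂u)
  ... | inj₁ ι₂x∈B₁ with ∈-image⁻ ι₂x∈B₁
  ...   | y , y∈B , ι₁y≡ι₂x = ⊥-elim (disjAB (y , x∈p∩q⁺ (proj₂ (cross y x ι₁y≡ι₂x) , y∈B)))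

  preimage₁A′≡B : preimage ι₁ A′ ≡ B
  preimage₁A′≡B = ⊆-antisym (λ x∈ → ι₁∈A′⇒∈B (∈-preimage⁻ x∈)) (λ x∈B → ∈-preimage⁺ (∈B⇒ι₁∈A′ x∈B))

  preimage₂A′≡⁅u⁆ : preimage ι₂ A′ ≡ ⁅ u ⁆
  preimage₂A′≡⁅u⁆ = ⊆-antisym (λ x∈ → subst (_∈ ⁅ u ⁆) (sym (ι₂∈A′⇒≡u (∈-preimage⁻ x∈))) (x∈⁅x⁆ u))
                              (λ x∈⁅u⁆ → ∈-preimage⁺ (subst (λ y → ι₂ y ∈ A′) (sym (x∈⁅y⁆⇒x≡y u x∈⁅u⁆)) ι₂u∈A′))

  ∣A′∣≡1+k : ∣ A′ ∣ ≡ suc k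
  ∣A′∣≡1+k = begin
    ∣ A′ ∣                                         ≡⟨ +-identityʳ _ ⟨
    ∣ A′ ∣ + 0                                     ≡⟨ cong (∣ A′ ∣ +_) (∣A∩W∣≡0 (λ x∈ → ι₁∈A′⇒∈B (∈-preimage⁻ x∈))) ⟨
    ∣ A′ ∣ + ∣ A ∩ preimage ι₁ A′ ∣                 ≡⟨ ∣∣-split A′ ⟩
    ∣ preimage ι₁ A′ ∣ + ∣ preimage ι₂ A′ ∣
      ≡⟨ cong₂ _+_ (cong ∣_∣ preimage₁A′≡B) (trans (cong ∣_∣ preimage₂A′≡⁅u⁆) (∣⁅x⁆∣≡1 u)) ⟩
    ∣ B ∣ + 1                                      ≡⟨ cong (_+ 1) sizeB ⟩
    k + 1                                          ≡⟨ +-comm k 1 ⟩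
    suc k                                          ∎
    where open ≡-Reasoning

  image₂⊆A′⇒⊆⁅u⁆ : ∀ {f} → image ι₂ f ⊆ A′ → f ⊆ ⁅ u ⁆
  image₂⊆A′⇒⊆⁅u⁆ img⊆ x∈f = subst (_∈ ⁅ u ⁆) (sym (ι₂∈A′⇒≡u (img⊆ (∈-image⁺ x∈f)))) (x∈⁅x⁆ u)

  A′-independent : Independent G A′
  A′-independent f′ f′∈ f′⊆A′ with edge-origin f′∈
  ... | f , f∈ , inj₁ refl = proj₁ goodB f f∈ (λ x∈f → ι₁∈A′⇒∈B (f′⊆A′ (∈-image⁺ x∈f)))
  ... | f , f∈ , inj₂ refl
    with s≤s () ← subst (_≤ 1) (All.lookup (three F) f∈)
                    (≤-trans (p⊆q⇒∣p∣≤∣q∣ (image₂⊆A′⇒⊆⁅u⁆ f′⊆A′)) (≤-reflexive (∣⁅x⁆∣≡1 u)))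

  private
    B⊆preimage : ∀ {U} → A′ ⊆ U → B ⊆ preimage ι₁ U
    B⊆preimage A′⊆U x∈B = ∈-preimage⁺ (A′⊆U (∈B⇒ι₁∈A′ x∈B))

    u∈preimage : ∀ {U} → A′ ⊆ U → u ∈ preimage ι₂ U
    u∈preimage A′⊆U = ∈-preimage⁺ (A′⊆U ι₂u∈A′)

  A′-good-bound : ∀ U → A′ ⊂ U → suc (suc k) + eInd G U ≤ ∣ U ∣
  A′-good-bound U (A′⊆U , z , z∈U , z∉A′) with any? (λ x → (x ∈? preimage ι₁ U) ×-dec ¬? (x ∈? B))
  ... | yes (x , x∈U₁ , x∉B) = deficiency-split U (suc k) 1 B-side (good-extension F goodA (u∈preimage A′⊆U) u∉A)
    where
    B-side : suc k + eInd F (preimage ι₁ U) ≤ ∣ preimage ι₁ U ∣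
    B-side = subst (λ m → suc m + eInd F (preimage ι₁ U) ≤ ∣ preimage ι₁ U ∣) sizeB
               (+a-+b≥+c⇒c+b≤a _ _ _ (proj₂ goodB (preimage ι₁ U) (B⊆preimage A′⊆U , x , x∈U₁ , x∉B)))
  ... | no ¬∃ = deficiency-split U k 2 B-side (subst (λ s → 2 + (eInd F (preimage ι₂ U) + s) ≤ ∣ preimage ι₂ U ∣) (sym A∩U₂≡0) U₂-dense)
    where
    U₁⊆B : preimage ι₁ U ⊆ B
    U₁⊆B {x} x∈U₁ with x ∈? B
    ... | yes x∈B = x∈B
    ... | no x∉B  = ⊥-elim (¬∃ (x , x∈U₁ , x∉B))
    B-side : k + eInd F (preimage ι₁ U) ≤ ∣ preimage ι₁ U ∣
    B-side rewrite ⊆-antisym U₁⊆B (B⊆preimage A′⊆U) | eInd-independent F (proj₁ goodB) | +-identityʳ k = ≤-reflexive (sym sizeB)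
    A∩U₂≡0 : ∣ A ∩ preimage ι₂ U ∣ ≡ 0
    A∩U₂≡0 = trans (∣A∩preimage₂∣≡∣A∩preimage₁∣ U) (∣A∩W∣≡0 U₁⊆B)
    other : ∃ λ y → y ∈ preimage ι₂ U × u ≢ y
    other with covered z
    ... | inj₁ (x , refl) = ⊥-elim (z∉A′ (∈B⇒ι₁∈A′ (U₁⊆B (∈-preimage⁺ z∈U))))
    ... | inj₂ (y , refl) = y , ∈-preimage⁺ z∈U , λ { refl → z∉A′ ι₂u∈A′ }
    U₂-dense : 2 + (eInd F (preimage ι₂ U) + 0) ≤ ∣ preimage ι₂ U ∣
    U₂-dense with other
    ... | y , y∈U₂ , u≢y rewrite +-identityʳ (eInd F (preimage ι₂ U)) =
      +a-+b≥+c⇒c+b≤a _ _ _ (dense (preimage ι₂ U) (two≤∣p∣ u≢y (u∈preimage A′⊆U) y∈U₂))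

  A′-good : Good G A′
  A′-good = A′-independent , λ U A′⊂U →
    c+b≤a⇒+a-+b≥+c _ _ _ (subst (λ m → suc m + eInd G U ≤ ∣ U ∣) (sym ∣A′∣≡1+k) (A′-good-bound U A′⊂U))

  dense-one-sided : ∀ U → 2 ≤ ∣ U ∣ → preimage ι₂ U ⊆ A → 2 + eInd G U ≤ ∣ U ∣
  dense-one-sided U 2≤∣U∣ U₂⊆A = deficiency-split U 2 0 U₁-dense U₂-side
    where
    U₂⊆A∩U₂ : preimage ι₂ U ⊆ A ∩ preimage ι₂ U
    U₂⊆A∩U₂ x∈U₂ = x∈p∩q⁺ (U₂⊆A x∈U₂ , x∈U₂)
    ∣U∣≤∣U₁∣ : ∣ U ∣ ≤ ∣ preimage ι₁ U ∣
    ∣U∣≤∣U₁∣ = +-cancelʳ-≤ ∣ A ∩ preimage ι₁ U ∣ _ _ (begin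
      ∣ U ∣ + ∣ A ∩ preimage ι₁ U ∣                   ≡⟨ ∣∣-split U ⟩
      ∣ preimage ι₁ U ∣ + ∣ preimage ι₂ U ∣           ≤⟨ +-monoʳ-≤ ∣ preimage ι₁ U ∣ (p⊆q⇒∣p∣≤∣q∣ U₂⊆A∩U₂) ⟩
      ∣ preimage ι₁ U ∣ + ∣ A ∩ preimage ι₂ U ∣       ≡⟨ cong (∣ preimage ι₁ U ∣ +_) (∣A∩preimage₂∣≡∣A∩preimage₁∣ U) ⟩
      ∣ preimage ι₁ U ∣ + ∣ A ∩ preimage ι₁ U ∣       ∎)
      where open ≤-Reasoning
    U₁-dense : 2 + eInd F (preimage ι₁ U) ≤ ∣ preimage ι₁ U ∣
    U₁-dense = +a-+b≥+c⇒c+b≤a _ _ _ (dense (preimage ι₁ U) (≤-trans 2≤∣U∣ ∣U∣≤∣U₁∣))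
    U₂-side : eInd F (preimage ι₂ U) + ∣ A ∩ preimage ι₂ U ∣ ≤ ∣ preimage ι₂ U ∣
    U₂-side rewrite eInd-independent F (λ f f∈ f⊆U₂ → proj₁ goodA f f∈ (λ x∈f → U₂⊆A (f⊆U₂ x∈f))) =
      ∣p∩q∣≤∣q∣ A (preimage ι₂ U)

  dense-two-sided : ∀ U {x y} → x ∈ preimage ι₁ U → x ∉ A → y ∈ preimage ι₂ U → y ∉ A → 2 + eInd G U ≤ ∣ U ∣
  dense-two-sided U x∈U₁ x∉A y∈U₂ y∉A =
    deficiency-split U 1 1 (≤-trans (s≤s (m≤m+n _ _)) (good-extension F goodA x∈U₁ x∉A)) (good-extension F goodA y∈U₂ y∉A)

  private
    m+m≢1 : ∀ m → m + m ≢ 1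
    m+m≢1 zero    ()
    m+m≢1 (suc m) m+m≡1 with () ← trans (sym (+-suc (suc m) m)) m+m≡1

  one-low-degree : ∀ f → f ∈ₗ edges F →
                   ∣ tabulate (λ z → does ((z ∈? image ι₁ f) ×-dec (deg G z ℕ.≟ 1))) ∣ ≤ 1
  one-low-degree f f∈ = begin
    ∣ tabulate (λ z → does (low₁ z)) ∣                ≡⟨ ∣tabulate∣≡∑ (λ z → does (low₁ z)) ⟩
    ∑[ z < n G ] 𝟙 (does (low₁ z))                   ≤⟨ ∑≤∑∘ι₁+∑∘ι₂ (λ z → 𝟙 (does (low₁ z))) ⟩
    ∑[ x < n F ] 𝟙 (does (low₁ (ι₁ x))) + ∑[ x < n F ] 𝟙 (does (low₁ (ι₂ x)))
                                                      ≡⟨ cong (∑[ x < n F ] 𝟙 (does (low₁ (ι₁ x))) +_) (∑-zero {n F} none-in-ι₂) ⟩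
    ∑[ x < n F ] 𝟙 (does (low₁ (ι₁ x))) + 0          ≡⟨ +-identityʳ _ ⟩
    ∑[ x < n F ] 𝟙 (does (low₁ (ι₁ x)))              ≤⟨ ∑-mono-≤ (λ x → 𝟙-does-mono (low₁ (ι₁ x)) (low x) (low₁⇒low x)) ⟩
    ∑[ x < n F ] 𝟙 (does (low x))                    ≡⟨ ∣tabulate∣≡∑ (λ x → does (low x)) ⟨
    ∣ tabulate (λ x → does (low x)) ∣                ≤⟨ oneLow f f∈ ⟩
    1                                                ∎
    where
    open ≤-Reasoning
    low₁ : ∀ z → Dec (z ∈ image ι₁ f × deg G z ≡ 1)
    low₁ z = (z ∈? image ι₁ f) ×-dec (deg G z ℕ.≟ 1)
    low : ∀ x → Dec (x ∈ f × deg F x ≡ 1)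
    low x = (x ∈? f) ×-dec (deg F x ℕ.≟ 1)
    none-in-ι₂ : ∀ x → 𝟙 (does (low₁ (ι₂ x))) ≡ 0
    none-in-ι₂ x = cong 𝟙 (dec-false (low₁ (ι₂ x)) not-low)
      where
      not-low : ¬ (ι₂ x ∈ image ι₁ f × deg G (ι₂ x) ≡ 1)
      not-low (ι₂x∈ , deg≡1) with ∈-image⁻ ι₂x∈
      ... | y , _ , ι₁y≡ι₂x with cross y x ι₁y≡ι₂x
      ...   | refl , x∈A = m+m≢1 (deg F x) (trans (sym (deg-ι₁-inside x∈A)) (trans (cong (deg G) (glue x x∈A)) deg≡1))
    low₁⇒low : ∀ x → ι₁ x ∈ image ι₁ f × deg G (ι₁ x) ≡ 1 → x ∈ f × deg F x ≡ 1
    low₁⇒low x (ι₁x∈ , deg≡1) with x ∈? A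
    ... | yes x∈A = ⊥-elim (m+m≢1 (deg F x) (trans (sym (deg-ι₁-inside x∈A)) deg≡1))
    ... | no x∉A  = ∈-image-ι₁ ι₁x∈ , trans (sym (deg-ι₁-outside x∉A)) deg≡1

⊆-by-dec : ∀ {m} {V W : Subset m} → ¬ (∃ λ x → x ∈ V × x ∉ W) → V ⊆ W
⊆-by-dec {W = W} ¬∃ {x} x∈V with x ∈? W
... | yes x∈W = x∈W
... | no x∉W  = ⊥-elim (¬∃ (x , x∈V , x∉W))

module DoubleIsEligible {F G : Hypergraph3} {k : ℕ} {ι₁ ι₂ : Fin (n F) → Fin (n G)}
                        (el : EligibleWith F (suc k)) (D : IsDoubleAlong F (EligibleWith.A el) G ι₁ ι₂) where
  open EligibleWith el
  open Doubling {F} {G} {A} {ι₁} {ι₂} D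
  private
    D′ : IsDoubleAlong F A G ι₂ ι₁
    D′ = IsDoubleAlong-swap {F} {A} {G} {ι₁} {ι₂} D
    module ₁ = DoubleOfEligible {F} {G} {k} {ι₁} {ι₂} el D
    module ₂ = DoubleOfEligible {F} {G} {k} {ι₂} {ι₁} el D′
    module Swapped = Doubling {F} {G} {A} {ι₂} {ι₁} D′
    open +-*-Solver

  Δ-double : Δ G ≡ ℤ.+ suc (suc k)
  Δ-double = a≡c+b⇒+a-+b≡+c (v G) (e G) (suc (suc k)) (+-cancelʳ-≡ k (v G) _ (begin
    v G + k                          ≡⟨ cong (v G +_) sizeA ⟨
    v G + ∣ A ∣                      ≡⟨ v-double ⟩
    v F + v F                        ≡⟨ cong₂ _+_ vF vF ⟩
    (suc k + e F) + (suc k + e F)    ≡⟨ solve 2 (λ k e → (con 1 :+ k :+ e) :+ (con 1 :+ k :+ e) := con 2 :+ k :+ con 2 :* e :+ k) refl k (e F) ⟩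
    suc (suc k) + 2 * e F + k        ≡⟨ cong (λ m → suc (suc k) + m + k) e-double ⟨
    suc (suc k) + e G + k            ∎))
    where
    open ≡-Reasoning
    vF : v F ≡ suc k + e F
    vF = +a-+b≡+c⇒a≡c+b (v F) (e F) (suc k) defic

  private
    hG : Fin (n G) → ℕ
    hG z = 𝟙 (does (1 ℕ.<? deg G z))

    hF : Fin (n F) → ℕ
    hF x = 𝟙 (does (1 ℕ.<? deg F x))

    hG-bound : ∀ (ι : Fin (n F) → Fin (n G)) → (∀ {x} → x ∉ A → deg G (ι x) ≡ deg F x) → (∀ {x} → x ∈ A → ι₁ x ≡ ι x) →
               ∀ x → hG (ι x) ≤ hF x + χ A x * hG (ι₁ x)
    hG-bound ι deg-outside ι₁≡ι x with x ∈? A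
    ... | yes x∈A rewrite ∈⇒lookup x∈A | ι₁≡ι x∈A = ≤-trans (≤-reflexive (sym (+-identityʳ (hG (ι x))))) (m≤n+m _ (hF x))
    ... | no x∉A  rewrite deg-outside x∉A = m≤m+n (hF x) _

  -- Summing over both copies counts the high-degree glued vertices twice; a counts them once more, and a ≤ |A| = k.
  highDeg-double : highDeg G ≤ highDeg F + highDeg F + k
  highDeg-double = ≤-trans (+-cancelʳ-≤ a _ _ twice) (+-monoʳ-≤ (highDeg F + highDeg F) a≤k)
    where
    a : ℕ
    a = ∑[ x < n F ] (χ A x * hG (ι₁ x))
    a≤k : a ≤ k
    a≤k = ≤-trans (∑-mono-≤ (λ x → ≤-trans (*-monoʳ-≤ (χ A x) (𝟙≤1 _)) (≤-reflexive (*-identityʳ (χ A x)))))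
                  (≤-reflexive (trans (sym (∣p∣≡∑χ A)) sizeA))
    ∑hF+a : ∑[ x < n F ] (hF x + χ A x * hG (ι₁ x)) ≡ highDeg F + a
    ∑hF+a = trans (∑-distrib-+ hF _) (cong (_+ a) (sym (∣tabulate∣≡∑ (λ x → does (1 ℕ.<? deg F x)))))
    twice : highDeg G + a ≤ highDeg F + highDeg F + a + a
    twice = begin
      highDeg G + a                                   ≡⟨ cong (_+ a) (∣tabulate∣≡∑ (λ z → does (1 ℕ.<? deg G z))) ⟩
      ∑[ z < n G ] hG z + a                           ≡⟨ double-count hG ⟨
      ∑[ x < n F ] hG (ι₁ x) + ∑[ x < n F ] hG (ι₂ x)
        ≤⟨ +-mono-≤ (≤-trans (∑-mono-≤ (hG-bound ι₁ deg-ι₁-outside (λ _ → refl))) (≤-reflexive ∑hF+a))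
                    (≤-trans (∑-mono-≤ (hG-bound ι₂ Swapped.deg-ι₁-outside (λ {x} → glue x))) (≤-reflexive ∑hF+a)) ⟩
      (highDeg F + a) + (highDeg F + a)              ≡⟨ solve 2 (λ h a → (h :+ a) :+ (h :+ a) := h :+ h :+ a :+ a) refl (highDeg F) a ⟩
      highDeg F + highDeg F + a + a                  ∎
      where open ≤-Reasoning

  few-high : 4 * (highDeg G + suc (suc k)) ≤ e G
  few-high = begin
    4 * (highDeg G + suc (suc k))                 ≤⟨ *-monoʳ-≤ 4 (+-monoˡ-≤ (suc (suc k)) highDeg-double) ⟩
    4 * (highDeg F + highDeg F + k + suc (suc k))
      ≡⟨ solve 2 (λ h k → con 4 :* (h :+ h :+ k :+ (con 2 :+ k)) := con 2 :* (con 4 :* (h :+ (con 1 :+ k)))) refl (highDeg F) k ⟩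
    2 * (4 * (highDeg F + suc k))                 ≤⟨ *-monoʳ-≤ 2 fewHigh ⟩
    2 * e F                                       ≡⟨ e-double ⟨
    e G                                           ∎
    where open ≤-Reasoning

  no-isolated : ∀ z → deg G z ≥ 1
  no-isolated z with covered z
  ... | inj₁ (x , refl) = ≤-trans (noIsolated x) (≤-trans (m≤m+n _ _) (≤-reflexive (sym (deg-ι₁ x))))
  ... | inj₂ (x , refl) = ≤-trans (noIsolated x) (≤-trans (m≤m+n _ _) (≤-reflexive (sym (Swapped.deg-ι₁ x))))

  dense-double : ∀ U → ∣ U ∣ ≥ 2 → ΔU G U ℤ.≥ ℤ.+ 2
  dense-double U 2≤∣U∣ = c+b≤a⇒+a-+b≥+c _ _ _ bound
    where
    outside-A : ∀ V → Dec (∃ λ x → x ∈ V × x ∉ A)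
    outside-A V = any? (λ x → (x ∈? V) ×-dec ¬? (x ∈? A))
    bound : 2 + eInd G U ≤ ∣ U ∣
    bound with outside-A (preimage ι₂ U) | outside-A (preimage ι₁ U)
    ... | no ¬∃₂ | _      = ₁.dense-one-sided U 2≤∣U∣ (⊆-by-dec ¬∃₂)
    ... | yes _  | no ¬∃₁ = ₂.dense-one-sided U 2≤∣U∣ (⊆-by-dec ¬∃₁)
    ... | yes (y , y∈U₂ , y∉A) | yes (x , x∈U₁ , x∉A) = ₁.dense-two-sided U x∈U₁ x∉A y∈U₂ y∉A

  new-good-sets-disjoint : Disjoint ₁.A′ ₂.A′
  new-good-sets-disjoint (z , z∈∩) with x∈p∩q⁻ ₁.A′ ₂.A′ z∈∩ | covered z
  ... | z∈₁ , z∈₂ | inj₁ (x , refl) = ₁.u∉B (subst (_∈ B) (₂.ι₂∈A′⇒≡u z∈₂) (₁.ι₁∈A′⇒∈B z∈₁))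
  ... | z∈₁ , z∈₂ | inj₂ (x , refl) = ₁.u∉B (subst (_∈ B) (₁.ι₂∈A′⇒≡u z∈₁) (₂.ι₁∈A′⇒∈B z∈₂))

  ι₁w∉ : ι₁ w ∉ ₁.A′ ∪ ₂.A′
  ι₁w∉ ι₁w∈ with x∈p∪q⁻ ₁.A′ ₂.A′ ι₁w∈
  ... | inj₁ ι₁w∈₁ = w∉A∪B (x∈p∪q⁺ (inj₂ (₁.ι₁∈A′⇒∈B ι₁w∈₁)))
  ... | inj₂ ι₁w∈₂ = u≢w (sym (₂.ι₂∈A′⇒≡u ι₁w∈₂))

  ι₂w∉ : ι₂ w ∉ ₁.A′ ∪ ₂.A′
  ι₂w∉ ι₂w∈ with x∈p∪q⁻ ₁.A′ ₂.A′ ι₂w∈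
  ... | inj₁ ι₂w∈₁ = u≢w (sym (₁.ι₂∈A′⇒≡u ι₂w∈₁))
  ... | inj₂ ι₂w∈₂ = w∉A∪B (x∈p∪q⁺ (inj₂ (₂.ι₁∈A′⇒∈B ι₂w∈₂)))

  ι₁w≢ι₂w : ι₁ w ≢ ι₂ w
  ι₁w≢ι₂w ι₁w≡ι₂w = w∉A∪B (x∈p∪q⁺ (inj₁ (proj₂ (cross w w ι₁w≡ι₂w))))

  one-low : ∀ f′ → f′ ∈ₗ edges G → ∣ tabulate (λ z → does ((z ∈? f′) ×-dec (deg G z ℕ.≟ 1))) ∣ ≤ 1
  one-low f′ f′∈ with edge-origin f′∈
  ... | f , f∈ , inj₁ refl = ₁.one-low-degree f f∈
  ... | f , f∈ , inj₂ refl = ₂.one-low-degree f f∈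

  doubling-eligible : EligibleWith G (suc (suc k))
  doubling-eligible = record
    { k≥1 = s≤s z≤n
    ; defic = Δ-double
    ; A = ₁.A′ ; B = ₂.A′
    ; goodA = ₁.A′-good ; goodB = ₂.A′-good
    ; disjAB = new-good-sets-disjoint
    ; sizeA = ₁.∣A′∣≡1+k ; sizeB = ₂.∣A′∣≡1+k
    ; u = ι₁ w ; w = ι₂ w
    ; u≢w = ι₁w≢ι₂w
    ; u∉A∪B = ι₁w∉ ; w∉A∪B = ι₂w∉
    ; fewHigh = few-high
    ; oneLow = one-low
    ; noIsolated = no-isolated
    ; dense = dense-double
    }

open import Data.Integer using (+_)

lemma2p3 : (F : Hypergraph3) (k : ℕ) (el : EligibleWith F k)
           (G : Hypergraph3) (ι₁ ι₂ : Fin (n F) → Fin (n G)) →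
           IsDoubleAlong F (EligibleWith.A el) G ι₁ ι₂ →
           Eligible G × Δ G ≡ + suc k × e G ≡ 2 * e F
lemma2p3 F zero    el G ι₁ ι₂ D with () ← EligibleWith.k≥1 el
lemma2p3 F (suc k) el G ι₁ ι₂ D = (suc (suc k) , doubling-eligible) , Δ-double , e-double
  where
  open DoubleIsEligible {F} {G} {k} {ι₁} {ι₂} el D
  open Doubling {F} {G} {EligibleWith.A el} {ι₁} {ι₂} D using (e-double)
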